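{- Let $E$ be a finite set and let $\Psi_1,\Psi_2:2^{E}\to 2^{E}$ be isotone operators (see context). Then $\mathcal{F}(\Psi_1)=\mathcal{F}(\Psi_2)$ if and only if $\Psi_1(X)=\Psi_2(X)$ for every $X\in\mathcal{F}(\Psi_1)$.
   Context: An operator $\Psi:2^E\to 2^E$ is considered only if $\Psi(X)\subseteq E\setminus X$ for every $X\subseteq E$; it is isotone if for all $X\subseteq Y\subseteq E$, $\Psi(X)\cap(E\setminus Y)\subseteq\Psi(Y)$. The family $\mathcal{F}(\Psi)$ generated by $\Psi$ consists of all $X\subseteq E$ for which there exist $x_1,\dots,x_m$ ($m\ge0$) with $X=\{x_1,\dots,x_m\}$ and $x_i\in\Psi(\{x_1,\dots,x_{i-1}\})$ for $1\le i\le m$. -}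

module Defs where

open import Data.Nat using (ℕ)
open import Data.Fin using (Fin)
open import Data.Fin.Subset using (Subset; ⊥; ⁅_⁆; _∪_; _∩_; ∁; _⊆_; _∈_)
open import Data.List using (List; []; _∷_; _++_; [_]; foldr)
open import Data.Product using (∃; _×_)
open import Relation.Binary.PropositionalEquality using (_≡_)

-- The ground set E is Fin n; subsets of E are Data.Fin.Subset n.
-- An operator on 2^E is a function Subset n → Subset n.
Operator : ℕ → Set
Operator n = Subset n → Subset n

IsOperator : ∀ {n} → Operator n → Set
IsOperator {n} Ψ = (X : Subset n) → Ψ X ⊆ ∁ X

Isotone : ∀ {n} → Operator n → Set
Isotone {n} Ψ = (X Y : Subset n) → X ⊆ Y → (Ψ X ∩ ∁ Y) ⊆ Ψ Y

setOf : ∀ {n} → List (Fin n) → Subset n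
setOf = foldr (λ x S → ⁅ x ⁆ ∪ S) ⊥

data Feasible {n} (Ψ : Operator n) : List (Fin n) → Set where
  nil  : Feasible Ψ []
  snoc : ∀ {xs x} → Feasible Ψ xs → x ∈ Ψ (setOf xs) → Feasible Ψ (xs ++ [ x ])

InFamily : ∀ {n} → Operator n → Subset n → Set
InFamily Ψ X = ∃ λ xs → Feasible Ψ xs × X ≡ setOf xs

-- If 𝓕(Φ) ⊆ 𝓕(Ψ), X ∈ 𝓕(Φ) and x ∈ Φ(X), then X ∪ {x} ∈ 𝓕(Ψ). In a Ψ-feasible
-- ordering of X ∪ {x}, the element x is added to a prefix contained in X, and
-- since x ∉ X isotonicity of Ψ lifts x ∈ Ψ(prefix) to x ∈ Ψ(X); so Φ ⊆ Ψ on 𝓕(Φ).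
-- Conversely, if the operators agree on 𝓕(Ψ₁), every sequence feasible for one
-- of them is feasible for the other, since all its prefixes lie in 𝓕(Ψ₁).
module Submission where

open import Defs
open import Data.Nat using (ℕ)
open import Data.Fin using (Fin)
open import Data.Fin.Subset using (Subset; _∈_; _∉_; _⊆_; ⁅_⁆; _∪_)
open import Data.Fin.Subset.Properties
open import Data.List using (List; []; _∷_; _++_; [_])
open import Data.Sum using (inj₁; inj₂)
open import Data.Product using (_,_)
open import Relation.Nullary using (yes; no; contradiction)
open import Function.Bundles using (_⇔_; mk⇔; Equivalence)
open import Relation.Binary.PropositionalEquality
  using (_≡_; refl; sym; trans; cong; subst)

module _ {n : ℕ} where

  setOf-++ : (xs ys : List (Fin n)) → setOf (xs ++ ys) ≡ setOf xs ∪ setOf ys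
  setOf-++ []       ys = sym (∪-identityˡ (setOf ys))
  setOf-++ (x ∷ xs) ys =
    trans (cong (⁅ x ⁆ ∪_) (setOf-++ xs ys)) (sym (∪-assoc ⁅ x ⁆ (setOf xs) (setOf ys)))

  setOf-∷ʳ : (xs : List (Fin n)) (x : Fin n) → setOf (xs ++ [ x ]) ≡ setOf xs ∪ ⁅ x ⁆
  setOf-∷ʳ xs x = trans (setOf-++ xs [ x ]) (cong (setOf xs ∪_) (∪-identityʳ ⁅ x ⁆))

  ∈-setOf-∷ʳ⁻ : ∀ xs {x y : Fin n} → y ∈ setOf (xs ++ [ x ]) → y ∉ setOf xs → y ≡ x
  ∈-setOf-∷ʳ⁻ xs {x} y∈ y∉xs with x∈p∪q⁻ (setOf xs) ⁅ x ⁆ (subst (_ ∈_) (setOf-∷ʳ xs x) y∈)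
  ... | inj₁ y∈xs  = contradiction y∈xs y∉xs
  ... | inj₂ y∈⁅x⁆ = x∈⁅y⁆⇒x≡y x y∈⁅x⁆

  setOf-⊆-∷ʳ : ∀ xs (x : Fin n) → setOf xs ⊆ setOf (xs ++ [ x ])
  setOf-⊆-∷ʳ xs x rewrite setOf-∷ʳ xs x = p⊆p∪q ⁅ x ⁆

  ⊆-∪⁅⁆⇒⊆ : ∀ {X Y : Subset n} {x} → x ∉ Y → Y ⊆ X ∪ ⁅ x ⁆ → Y ⊆ X
  ⊆-∪⁅⁆⇒⊆ {X} {Y} {x} x∉Y Y⊆X∪x {y} y∈Y with x∈p∪q⁻ X ⁅ x ⁆ (Y⊆X∪x y∈Y)
  ... | inj₁ y∈X  = y∈X
  ... | inj₂ y∈⁅x⁆ = contradiction (subst (_∈ Y) (x∈⁅y⁆⇒x≡y x y∈⁅x⁆) y∈Y) x∉Y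

  InFamily-∪⁅⁆ : ∀ {Ψ : Operator n} {X x} → InFamily Ψ X → x ∈ Ψ X → InFamily Ψ (X ∪ ⁅ x ⁆)
  InFamily-∪⁅⁆ {x = x} (xs , f , refl) x∈ΨX = xs ++ [ x ] , snoc f x∈ΨX , sym (setOf-∷ʳ xs x)

  InFamily-map : ∀ {Φ Ψ : Operator n} → (∀ {xs} → Feasible Φ xs → Feasible Ψ xs)
               → ∀ {X} → InFamily Φ X → InFamily Ψ X
  InFamily-map feasible (xs , f , X≡xs) = xs , feasible f , X≡xs

  module _ {Ψ : Operator n} (isotone : Isotone Ψ) where

    ∈-feasible⇒∈Ψ : ∀ {ys X x} → Feasible Ψ ys → x ∈ setOf ys → x ∉ X
                   → setOf ys ⊆ X ∪ ⁅ x ⁆ → x ∈ Ψ X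
    ∈-feasible⇒∈Ψ nil x∈ _ _ = contradiction x∈ ∉⊥
    ∈-feasible⇒∈Ψ {X = X} {x} (snoc {zs} {z} f z∈Ψzs) x∈ x∉X ys⊆X∪x with x ∈? setOf zs
    ... | yes x∈zs = ∈-feasible⇒∈Ψ f x∈zs x∉X (⊆-trans (setOf-⊆-∷ʳ zs z) ys⊆X∪x)
    ... | no x∉zs with ∈-setOf-∷ʳ⁻ zs x∈ x∉zs
    ... | refl = isotone (setOf zs) X zs⊆X (x∈p∩q⁺ (z∈Ψzs , x∉p⇒x∈∁p x∉X))
      where
      zs⊆X : setOf zs ⊆ X
      zs⊆X = ⊆-∪⁅⁆⇒⊆ x∉zs (⊆-trans (setOf-⊆-∷ʳ zs z) ys⊆X∪x)

  family-⊆⇒Ψ-⊆ : ∀ {Φ Ψ : Operator n} → IsOperator Φ → Isotone Ψ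
               → (∀ X → InFamily Φ X → InFamily Ψ X)
               → ∀ X → InFamily Φ X → Φ X ⊆ Ψ X
  family-⊆⇒Ψ-⊆ isOperator isotone 𝓕Φ⊆𝓕Ψ X X∈𝓕Φ {x} x∈ΦX
    with 𝓕Φ⊆𝓕Ψ (X ∪ ⁅ x ⁆) (InFamily-∪⁅⁆ X∈𝓕Φ x∈ΦX)
  ... | ys , g , X∪x≡ys =
    ∈-feasible⇒∈Ψ isotone g
      (subst (x ∈_) X∪x≡ys (q⊆p∪q X ⁅ x ⁆ (x∈⁅x⁆ x)))
      (x∈∁p⇒x∉p (isOperator X x∈ΦX))
      (⊆-reflexive (sym X∪x≡ys))

  feasible-monoˡ : ∀ {Φ Ψ : Operator n} → (∀ X → InFamily Φ X → Φ X ⊆ Ψ X)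
                 → ∀ {xs} → Feasible Φ xs → Feasible Ψ xs
  feasible-monoˡ Φ⊆Ψ nil             = nil
  feasible-monoˡ Φ⊆Ψ (snoc f x∈Φxs) = snoc (feasible-monoˡ Φ⊆Ψ f) (Φ⊆Ψ _ (_ , f , refl) x∈Φxs)

  feasible-monoʳ : ∀ {Φ Ψ : Operator n} → (∀ X → InFamily Ψ X → Φ X ⊆ Ψ X)
                 → ∀ {xs} → Feasible Φ xs → Feasible Ψ xs
  feasible-monoʳ Φ⊆Ψ nil             = nil
  feasible-monoʳ {Ψ = Ψ} Φ⊆Ψ (snoc {xs} g x∈Φxs) = snoc f (Φ⊆Ψ _ (xs , f , refl) x∈Φxs)
    where
    f : Feasible Ψ xs
    f = feasible-monoʳ Φ⊆Ψ g

corollary1 : (n : ℕ) (Ψ₁ Ψ₂ : Operator n)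
    → IsOperator Ψ₁ → IsOperator Ψ₂ → Isotone Ψ₁ → Isotone Ψ₂
    → ((∀ (X : Subset n) → InFamily Ψ₁ X ⇔ InFamily Ψ₂ X)
       ⇔ (∀ (X : Subset n) → InFamily Ψ₁ X → Ψ₁ X ≡ Ψ₂ X))
corollary1 n Ψ₁ Ψ₂ isOperator₁ isOperator₂ isotone₁ isotone₂ = mk⇔ same⇒agree agree⇒same
  where
  same⇒agree : (∀ X → InFamily Ψ₁ X ⇔ InFamily Ψ₂ X) → ∀ X → InFamily Ψ₁ X → Ψ₁ X ≡ Ψ₂ X
  same⇒agree 𝓕₁≡𝓕₂ X X∈𝓕₁ = ⊆-antisym
    (family-⊆⇒Ψ-⊆ isOperator₁ isotone₂ (λ Y → Equivalence.to (𝓕₁≡𝓕₂ Y)) X X∈𝓕₁)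
    (family-⊆⇒Ψ-⊆ isOperator₂ isotone₁ (λ Y → Equivalence.from (𝓕₁≡𝓕₂ Y)) X
       (Equivalence.to (𝓕₁≡𝓕₂ X) X∈𝓕₁))

  agree⇒same : (∀ X → InFamily Ψ₁ X → Ψ₁ X ≡ Ψ₂ X) → ∀ X → InFamily Ψ₁ X ⇔ InFamily Ψ₂ X
  agree⇒same Ψ₁≡Ψ₂ X = mk⇔
    (InFamily-map (feasible-monoˡ λ Y Y∈𝓕₁ → ⊆-reflexive (Ψ₁≡Ψ₂ Y Y∈𝓕₁)))
    (InFamily-map (feasible-monoʳ λ Y Y∈𝓕₁ → ⊆-reflexive (sym (Ψ₁≡Ψ₂ Y Y∈𝓕₁))))
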